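{- Let $\Sigma$ be a finite totally ordered alphabet and let $\prec$ denote $V$-order on $\Sigma^*$. For any two strings $\mathbf{x},\mathbf{y}\in\Sigma^*$ and letters $\lambda,\mu\in\Sigma$ with $\lambda\le\mu$: (i) if $\mathbf{x}\prec\mathbf{y}$ then $\lambda\mathbf{x}\prec\mu\mathbf{y}$; (ii) if $\mathbf{x}\prec\mathbf{y}$ then $\mathbf{x}\lambda\prec\mathbf{y}\mu$.
   Context: $\Sigma^*$ denotes the set of all finite strings over $\Sigma$, including the empty string $\varepsilon$. For a nonempty string $\mathbf{x}=x_1x_2\cdots x_n$, define $h\in\{1,\ldots,n\}$ by $h=1$ if $x_1\le x_2\le\cdots\le x_n$, and otherwise as the unique index with $x_{h-1}>x_h\le x_{h+1}\le\cdots\le x_n$; let $\mathbf{x}^*$ be the string obtained from $\mathbf{x}$ by deleting the letter $x_h$. Write $\mathbf{x}^{s*}$ for the result of applying $^*$ $s$ times ($\mathbf{x}^{0*}=\mathbf{x}$); the sequence $\mathbf{x},\mathbf{x}^*,\mathbf{x}^{2*},\ldots$ ends with $\varepsilon$. $V$-order $\prec$ is defined for distinct strings $\mathbf{x},\mathbf{y}$ as follows: $\mathbf{x}\prec\mathbf{y}$ if $\mathbf{x}$ occurs in the sequence $\mathbf{y},\mathbf{y}^*,\mathbf{y}^{2*},\ldots,\varepsilon$. If neither string occurs in the other's sequence, there are smallest $s,t\ge 0$ with $\mathbf{x}^{(s+1)*}=\mathbf{y}^{(t+1)*}$; put $\mathbf{s}=\mathbf{x}^{s*}$, $\mathbf{t}=\mathbf{y}^{t*}$,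 which are distinct strings of equal length $m$; let $j\in\{1,\ldots,m\}$ be the largest index with $\mathbf{s}[j]\ne\mathbf{t}[j]$; then $\mathbf{x}\prec\mathbf{y}$ iff $\mathbf{s}[j]<\mathbf{t}[j]$ in $\Sigma$. This is a strict total order on $\Sigma^*$. -}

module Defs where

open import Data.Nat using (ℕ; zero; suc; _+_)
import Data.Nat as ℕ
open import Data.Fin using (Fin; _≤_; _<_; _≤?_)
open import Data.List using (List; []; _∷_; _++_; length)
open import Data.Bool using (Bool; true; false; if_then_else_; _∧_)
open import Data.Product using (Σ; ∃; ∃-syntax; _×_; _,_)
open import Data.Sum using (_⊎_)
open import Relation.Binary.PropositionalEquality using (_≡_; _≢_)
open import Relation.Nullary using (¬_; does)

-- The alphabet Σ is a finite totally ordered set, modelled as Fin k with its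
-- natural order (every finite total order is isomorphic to one of these).
-- Strings are lists of letters; x₁ is the head of the list.

nondec : ∀ {k} → List (Fin k) → Bool
nondec [] = true
nondec (a ∷ []) = true
nondec (a ∷ b ∷ xs) = does (a ≤? b) ∧ nondec (b ∷ xs)

-- x* : delete the letter x_h, where h is the least index such that
-- x_h ≤ x_{h+1} ≤ ⋯ ≤ x_n (h = 1 if x is nondecreasing; otherwise
-- x_{h-1} > x_h).  If x is not nondecreasing then h ≥ 2 and h - 1 is the
-- corresponding index for the tail, which gives the recursion below.
-- (ε* is never used by the definition of V-order; we set it to ε.)
star : ∀ {k} → List (Fin k) → List (Fin k)
star [] = []
star (a ∷ xs) = if nondec (a ∷ xs) then xs else (a ∷ star xs)

star^ : ∀ {k} → ℕ → List (Fin k) → List (Fin k)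
star^ zero x = x
star^ (suc s) x = star (star^ s x)

InSeq : ∀ {k} → List (Fin k) → List (Fin k) → Set
InSeq x y = ∃[ s ] star^ s y ≡ x

-- s and t (of equal length) have largest differing index j with s[j] < t[j]:
-- s = u a w, t = v b w with |u| = |v| and a < b.
LastDiffLess : ∀ {k} → List (Fin k) → List (Fin k) → Set
LastDiffLess {k} s t =
  ∃[ u ] ∃[ v ] ∃[ w ] Σ (Fin k) λ a → Σ (Fin k) λ b →
    s ≡ u ++ (a ∷ w) × t ≡ v ++ (b ∷ w) × length u ≡ length v × a < b

_≺_ : ∀ {k} → List (Fin k) → List (Fin k) → Set
x ≺ y =
  (x ≢ y × InSeq x y)
  ⊎ (¬ InSeq x y × ¬ InSeq y x ×
     ∃[ s ] ∃[ t ]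
       (star^ (suc s) x ≡ star^ (suc t) y
        × (∀ s′ t′ → star^ (suc s′) x ≡ star^ (suc t′) y → s ℕ.≤ s′ × t ℕ.≤ t′)
        × LastDiffLess (star^ s x) (star^ t y)))

infix 4 _≺_

module Submission where

-- Both parts follow from one argument about an operation ext α that adds a
-- letter α to a string, at the front (α ∷ w) or at the back (w ∷ʳ α).  Along
-- the sequence ext α w, (ext α w)*, … the added letter survives until the first
-- step j at which it is the deleted letter, and from then on the sequence is
-- that of w: star^ (1 + n) (ext α w) = star^ n w for n ≥ j.  Hence if the
-- sequences of x and y fork, i.e. merge right after star^ s x and star^ t y,
-- which are compared at their last differing letter, then those of ext α x and
-- ext α y fork essentially at the same places, shifted by one step on each side
-- that has already shed α; and ext l w, ext m w fork in the right order when
-- l < m.  The minimality clauses in the definition of V-order follow from the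
-- fork, and without them the order is visibly transitive, which gives
-- ext l x ≺ ext m x ≺ ext m y.

open import Defs
open import Data.Bool using (_∧_)
open import Data.Fin using (Fin; _≤_; _<_; _≤?_; _<?_)
import Data.Fin.Properties as Fin
open import Data.List using (List; []; _∷_; _∷ʳ_; _++_; length; last)
open import Data.List.Properties using (≡-dec; length-++; ∷ʳ-injectiveˡ)
open import Data.List.Relation.Unary.Linked using (Linked; []; [-]; _∷_; linked?)
open import Data.List.Relation.Unary.Linked.Properties using (++⁺)
open import Data.List.Reverse using (Reverse; []; _∶_∶ʳ_; reverseView)
open import Data.Maybe using (just; nothing)
open import Data.Maybe.Relation.Binary.Connected using (Connected; just; nothing-just)
open import Data.Maybe.Relation.Unary.All as All using (All; just; nothing; drop-just)
open import Data.Nat using (ℕ; zero; suc; _+_; _∸_; pred; z≤n; s≤s)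
  renaming (_≤_ to _≤ℕ_; _<_ to _<ℕ_)
import Data.Nat.Properties as ℕ
open import Data.Product using (_×_; _,_; ∃-syntax; proj₁; proj₂)
open import Data.Sum using (_⊎_; inj₁; inj₂)
open import Function using (_∘_)
open import Relation.Binary.Definitions using (Decidable; tri<; tri≈; tri>)
open import Relation.Binary.PropositionalEquality
open import Relation.Nullary using (¬_; Dec; yes; no; does; contradiction)
open import Relation.Nullary.Decidable using (dec-true; dec-false)

-- Fin's _≤_ and _<_ are ℕ's order on toℕ, so Data.Nat.Properties applies to letters.

private variable
  k m n : ℕ
  a b α : Fin k
  c d u v w x y z : List (Fin k)

Least : (ℕ → Set) → Set
Least P = ∃[ j ] P j × (∀ {i} → i <ℕ j → ¬ P i)

least : {P : ℕ → Set} → (∀ i → Dec (P i)) → ∀ n → P n → Least P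
least P? zero    p = 0 , p , λ ()
least P? (suc n) p with P? 0
... | yes p₀ = 0 , p₀ , λ ()
... | no ¬p₀ with least (λ i → P? (suc i)) n p
...   | j , pj , below = suc j , pj , λ { {zero} _ → ¬p₀ ; {suc i} (s≤s i<j) → below i<j }

nondec≡linked? : (w : List (Fin k)) → nondec w ≡ does (linked? _≤?_ w)
nondec≡linked? []          = refl
nondec≡linked? (a ∷ [])    = refl
nondec≡linked? (a ∷ b ∷ w) = cong (does (a ≤? b) ∧_) (nondec≡linked? (b ∷ w))

star-linked : Linked _≤_ (a ∷ w) → star (a ∷ w) ≡ w
star-linked {a = a} {w = w} sorted
  rewrite nondec≡linked? (a ∷ w) | dec-true (linked? _≤?_ (a ∷ w)) sorted = refl

star-unlinked : ¬ Linked _≤_ (a ∷ w) → star (a ∷ w) ≡ a ∷ star w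
star-unlinked {a = a} {w = w} unsorted
  rewrite nondec≡linked? (a ∷ w) | dec-false (linked? _≤?_ (a ∷ w)) unsorted = refl

length-star : (w : List (Fin k)) → length (star w) ≡ pred (length w)
length-star []          = refl
length-star (a ∷ [])    = refl
length-star (a ∷ b ∷ w) with linked? _≤?_ (a ∷ b ∷ w) | length-star (b ∷ w)
... | yes sorted   | _  = cong length (star-linked sorted)
... | no  unsorted | ih = trans (cong length (star-unlinked unsorted)) (cong suc ih)

length-star-< : w ≢ [] → length (star w) <ℕ length w
length-star-< {w = []}    w≢[] = contradiction refl w≢[]
length-star-< {w = a ∷ w} _    = subst (_<ℕ suc (length w)) (sym (length-star (a ∷ w))) ℕ.≤-refl

star^-[] : ∀ n → star^ n [] ≡ ([] {A = Fin k})
star^-[] zero    = refl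
star^-[] (suc n) = cong star (star^-[] n)

star^-+ : ∀ m n (w : List (Fin k)) → star^ (m + n) w ≡ star^ m (star^ n w)
star^-+ zero    n w = refl
star^-+ (suc m) n w = cong star (star^-+ m n w)

star^-∸ : ∀ (w : List (Fin k)) → m ≤ℕ n → star^ n w ≡ star^ (n ∸ m) (star^ m w)
star^-∸ {m = m} {n = n} w m≤n =
  trans (cong (λ i → star^ i w) (sym (ℕ.m∸n+n≡m m≤n))) (star^-+ (n ∸ m) m w)

star^-shift : ∀ {i j} → star^ i x ≡ star^ j y → i ≤ℕ n → star^ n x ≡ star^ (n ∸ i + j) y
star^-shift {x = x} {y = y} {n = n} {i} {j} eq i≤n = begin
  star^ n x                 ≡⟨ star^-∸ x i≤n ⟩
  star^ (n ∸ i) (star^ i x) ≡⟨ cong (star^ (n ∸ i)) eq ⟩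
  star^ (n ∸ i) (star^ j y) ≡⟨ star^-+ (n ∸ i) j y ⟨
  star^ (n ∸ i + j) y       ∎
  where open ≡-Reasoning

length-star^ : ∀ n (w : List (Fin k)) → length (star^ n w) ≡ length w ∸ n
length-star^ zero    w = refl
length-star^ (suc n) w = begin
  length (star (star^ n w)) ≡⟨ length-star (star^ n w) ⟩
  pred (length (star^ n w)) ≡⟨ cong pred (length-star^ n w) ⟩
  pred (length w ∸ n)       ≡⟨ ℕ.pred[m∸n]≡m∸[1+n] (length w) n ⟩
  length w ∸ suc n          ∎
  where open ≡-Reasoning

length-star^-≤ : ∀ n (w : List (Fin k)) → length (star^ n w) ≤ℕ length w
length-star^-≤ n w = subst (_≤ℕ length w) (sym (length-star^ n w)) (ℕ.m∸n≤m (length w) n)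

length-star^-< : star^ m w ≢ [] → m <ℕ n → length (star^ n w) <ℕ length (star^ m w)
length-star^-< {m = m} {w = w} {n = n} ne m<n = begin-strict
  length (star^ n w)                            ≡⟨ cong length (star^-∸ w m<n) ⟩
  length (star^ (n ∸ suc m) (star (star^ m w))) ≡⟨ length-star^ (n ∸ suc m) _ ⟩
  length (star (star^ m w)) ∸ (n ∸ suc m)       ≤⟨ ℕ.m∸n≤m _ (n ∸ suc m) ⟩
  length (star (star^ m w))                     <⟨ length-star-< ne ⟩
  length (star^ m w)                            ∎
  where open ℕ.≤-Reasoning

star^-length : (w : List (Fin k)) → star^ (length w) w ≡ []
star^-length w with star^ (length w) w | length-star^ (length w) w
... | []    | _  = refl
... | _ ∷ _ | eq = contradiction (trans eq (ℕ.n∸n≡0 (length w))) λ ()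

length<⇒≢ : length u <ℕ length v → u ≢ v
length<⇒≢ |u|<|v| refl = ℕ.<-irrefl refl |u|<|v|

InSeq-trans : InSeq x y → InSeq y w → InSeq x w
InSeq-trans {w = w} (r , refl) (r′ , refl) = r + r′ , star^-+ r r′ w

InSeq-star^ : ∀ n → InSeq x y → InSeq (star^ n x) y
InSeq-star^ {y = y} n (r , refl) = n + r , star^-+ n r y

InSeq⇒length< : x ≢ y → InSeq x y → length x <ℕ length y
InSeq⇒length< x≢y (zero , refl)             = contradiction refl x≢y
InSeq⇒length< {y = []} x≢y (suc r , refl)  = contradiction (star^-[] (suc r)) x≢y
InSeq⇒length< {y = b ∷ y} _ (suc r , refl) =
  length-star^-< {m = 0} {w = b ∷ y} {n = suc r} (λ ()) (s≤s z≤n)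

InSeq-length-injective : star^ n y ≢ [] → InSeq v y → length v ≡ length (star^ n y) →
                         v ≡ star^ n y
InSeq-length-injective {n = n} {y = y} ne (m , refl) eq = cong (λ i → star^ i y) m≡n
  where
  positive : length (star^ n y) ≢ 0
  positive len≡0 with star^ n y
  ... | []    = ne refl
  ... | _ ∷ _ = contradiction len≡0 λ ()
  lengths : length y ∸ m ≡ length y ∸ n
  lengths = trans (sym (length-star^ m y)) (trans eq (length-star^ n y))
  n<len : n <ℕ length y
  n<len = ℕ.m∸n≢0⇒n<m (subst (_≢ 0) (length-star^ n y) positive)
  m<len : m <ℕ length y
  m<len = ℕ.m∸n≢0⇒n<m (subst (_≢ 0) (trans (length-star^ n y) (sym lengths)) positive)
  m≡n : m ≡ n
  m≡n = ℕ.∸-cancelˡ-≡ (ℕ.<⇒≤ m<len) (ℕ.<⇒≤ n<len) lengths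

-- Colexicographic comparison of strings of equal length

infix 4 _<colex_

data _<colex_ : List (Fin k) → List (Fin k) → Set where
  here  : a < b → (a ∷ w) <colex (b ∷ w)
  there : ∀ a b → u <colex v → (a ∷ u) <colex (b ∷ v)

<colex-irrefl : ¬ w <colex w
<colex-irrefl (here a<a)    = ℕ.<-irrefl refl a<a
<colex-irrefl (there _ _ p) = <colex-irrefl p

<colex⇒≢ : u <colex v → u ≢ v
<colex⇒≢ p refl = <colex-irrefl p

<colex-trans : u <colex v → v <colex w → u <colex w
<colex-trans (here a<b)    (here b<c)    = here (ℕ.<-trans a<b b<c)
<colex-trans (here _)      (there _ c q) = there _ c q
<colex-trans (there a _ p) (here _)      = there a _ p
<colex-trans (there a _ p) (there _ c q) = there a c (<colex-trans p q)

<colex⇒length≡ : u <colex v → length u ≡ length v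
<colex⇒length≡ (here _)      = refl
<colex⇒length≡ (there _ _ p) = cong suc (<colex⇒length≡ p)

<colex⇒≢[]ˡ : u <colex v → u ≢ []
<colex⇒≢[]ˡ (here _)      ()
<colex⇒≢[]ˡ (there _ _ _) ()

<colex⇒≢[]ʳ : u <colex v → v ≢ []
<colex⇒≢[]ʳ (here _)      ()
<colex⇒≢[]ʳ (there _ _ _) ()

<colex-∷-head : (a ∷ w) <colex (b ∷ w) → a < b
<colex-∷-head (here a<b)    = a<b
<colex-∷-head (there _ _ p) = contradiction p <colex-irrefl

LastDiffLess⇒<colex : LastDiffLess u v → u <colex v
LastDiffLess⇒<colex (u , v , w , a , b , refl , refl , |u|≡|v| , a<b) = go u v |u|≡|v|
  where
  go : ∀ u v → length u ≡ length v → (u ++ a ∷ w) <colex (v ++ b ∷ w)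
  go []      []      _   = here a<b
  go (c ∷ u) (d ∷ v) len = there c d (go u v (ℕ.suc-injective len))

<colex⇒LastDiffLess : u <colex v → LastDiffLess u v
<colex⇒LastDiffLess (here a<b) = [] , [] , _ , _ , _ , refl , refl , refl , a<b
<colex⇒LastDiffLess (there a b p) with <colex⇒LastDiffLess p
... | u , v , w , c , d , refl , refl , len , c<d =
  a ∷ u , b ∷ v , w , c , d , refl , refl , cong suc len , c<d

-- V-order without its minimality clauses

Fork : List (Fin k) → List (Fin k) → Set
Fork x y = ∃[ s ] ∃[ t ] star (star^ s x) ≡ star (star^ t y) × star^ s x <colex star^ t y

fork : ∀ s t → star^ s x ≡ u → star^ t y ≡ v → star u ≡ star v → u <colex v → Fork x y
fork s t refl refl meet lt = s , t , meet , lt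

infix 4 _≺′_

_≺′_ : List (Fin k) → List (Fin k) → Set
x ≺′ y = (x ≢ y × InSeq x y) ⊎ Fork x y

≺⇒≺′ : x ≺ y → x ≺′ y
≺⇒≺′ (inj₁ descendant)                        = inj₁ descendant
≺⇒≺′ (inj₂ (_ , _ , s , t , meet , _ , diff)) = inj₂ (s , t , meet , LastDiffLess⇒<colex diff)

≺′⇒≺ : x ≺′ y → x ≺ y
≺′⇒≺ (inj₁ descendant)                           = inj₁ descendant
≺′⇒≺ {x = x} {y = y} (inj₂ (s , t , meet , lt)) =
  inj₂ (x∉y , y∉x , s , t , meet , minimal , <colex⇒LastDiffLess lt)
  where
  on-level-of-x : InSeq v x → length v ≡ length (star^ t y) → v ≡ star^ s x
  on-level-of-x v∈x eq =
    InSeq-length-injective {n = s} {y = x} (<colex⇒≢[]ˡ lt) v∈x (trans eq (sym (<colex⇒length≡ lt)))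

  on-level-of-y : InSeq v y → length v ≡ length (star^ s x) → v ≡ star^ t y
  on-level-of-y v∈y eq =
    InSeq-length-injective {n = t} {y = y} (<colex⇒≢[]ʳ lt) v∈y (trans eq (<colex⇒length≡ lt))

  x∉y : ¬ InSeq x y
  x∉y x∈y = <colex⇒≢ lt (on-level-of-y (InSeq-star^ s x∈y) refl)

  y∉x : ¬ InSeq y x
  y∉x y∈x = <colex⇒≢ lt (sym (on-level-of-x (InSeq-star^ t y∈x) refl))

  minimal : ∀ s′ t′ → star^ (suc s′) x ≡ star^ (suc t′) y → s ≤ℕ s′ × t ≤ℕ t′
  minimal s′ t′ eq = ℕ.≮⇒≥ s≮s′ , ℕ.≮⇒≥ t≮t′
    where
    s≮s′ : ¬ s′ <ℕ s
    s≮s′ s′<s =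
      <colex⇒≢ lt (on-level-of-y (s ∸ suc s′ + suc t′ , sym (star^-shift eq s′<s)) refl)
    t≮t′ : ¬ t′ <ℕ t
    t≮t′ t′<t =
      <colex⇒≢ lt (sym (on-level-of-x (t ∸ suc t′ + suc s′ , sym (star^-shift (sym eq) t′<t)) refl))

≺′-trans : x ≺′ y → y ≺′ w → x ≺′ w
≺′-trans (inj₁ (x≢y , x∈y)) (inj₁ (y≢w , y∈w)) =
  inj₁ (length<⇒≢ (ℕ.<-trans (InSeq⇒length< x≢y x∈y) (InSeq⇒length< y≢w y∈w)) , InSeq-trans x∈y y∈w)
≺′-trans {x = x} {w = w} (inj₁ (_ , r , yr≡x)) (inj₂ (p , q , meet , lt)) with ℕ.≤-<-connex r p
... | inj₁ r≤p = inj₂ (fork (p ∸ r + 0) q (sym (star^-shift yr≡x r≤p)) refl meet lt)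
... | inj₂ p<r = inj₁ (length<⇒≢ (ℕ.<-≤-trans below-q (length-star^-≤ q w)) , x∈w)
  where
  x∈w : InSeq x w
  x∈w = r ∸ suc p + suc q , trans (sym (star^-shift meet p<r)) yr≡x
  below-q : length x <ℕ length (star^ q w)
  below-q = subst (λ v → length v <ℕ length (star^ q w)) (proj₂ x∈w)
              (length-star^-< (<colex⇒≢[]ʳ lt) (ℕ.m≤n+m (suc q) (r ∸ suc p)))
≺′-trans {w = w} (inj₂ (p , q , meet , lt)) (inj₁ (_ , r , wr≡y)) =
  inj₂ (fork p (q + r) refl (trans (star^-+ q r w) (cong (star^ q) wr≡y)) meet lt)
≺′-trans (inj₂ (p , q , meet , lt)) (inj₂ (p′ , q′ , meet′ , lt′)) with ℕ.<-cmp q p′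
... | tri≈ _ refl _ = inj₂ (p , q′ , trans meet meet′ , <colex-trans lt lt′)
... | tri< q<p′ _ _ =
  inj₂ (fork (p′ ∸ suc q + suc p) q′
    (sym (star^-shift {i = suc q} {j = suc p} (sym meet) q<p′)) refl meet′ lt′)
... | tri> _ _ p′<q =
  inj₂ (fork p (q ∸ suc p′ + suc q′)
    refl (sym (star^-shift {i = suc p′} {j = suc q′} meet′ p′<q)) meet lt)

-- Adding one letter

record Extension (k : ℕ) : Set₁ where
  field
    ext    : Fin k → List (Fin k) → List (Fin k)
    Drops  : Fin k → List (Fin k) → Set
    drops? : Decidable Drops

    star-ext-drops : ∀ {α w} → Drops α w → star (ext α w) ≡ w
    star-ext-keeps : ∀ {α w} → ¬ Drops α w → star (ext α w) ≡ ext α (star w)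
    length-ext     : ∀ {α w} → length (ext α w) ≡ suc (length w)

    drops-[]       : ∀ {α} → Drops α []
    drops-star     : ∀ {α w} → Drops α w → Drops α (star w)
    drops-antitone : ∀ {l m w} → l ≤ m → Drops m w → Drops l w

    ext-monoˡ-<colex  : ∀ {l m w} → l < m → ext l w <colex ext m w
    ext-monoʳ-<colex  : ∀ {α u v} → u <colex v → ext α u <colex ext α v
    parent-<colex-ext : ∀ {α c z} → star c ≡ z → star (ext α z) ≡ z → ¬ Drops α c →
                        c ≢ ext α z → c <colex ext α z
    ext-<colex-parent : ∀ {α c z} → star c ≡ z → Drops α c → c ≢ [] →
                        c ≢ ext α z → ext α z <colex c
    drops-mono-<colex : ∀ {α c d} → star c ≡ star d → c <colex d → Drops α c → Drops α d

module Extend (E : Extension k) where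
  open Extension E

  private
    _≟ˡ_ : (u v : List (Fin k)) → Dec (u ≡ v)
    _≟ˡ_ = ≡-dec Fin._≟_

  KeepsBefore : Fin k → List (Fin k) → ℕ → Set
  KeepsBefore α w j = ∀ {i} → i <ℕ j → ¬ Drops α (star^ i w)

  dropIndex : ∀ α w → ∃[ j ] Drops α (star^ j w) × KeepsBefore α w j
  dropIndex α w =
    least (λ j → drops? α (star^ j w)) (length w) (subst (Drops α) (sym (star^-length w)) drops-[])

  drops-star^ : ∀ n → Drops α w → Drops α (star^ n w)
  drops-star^ zero    d = d
  drops-star^ (suc n) d = drops-star (drops-star^ n d)

  drops-later : ∀ {j} → Drops α (star^ j w) → j ≤ℕ n → Drops α (star^ n w)
  drops-later {α = α} {w = w} {n = n} {j} d j≤n =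
    subst (Drops α) (sym (star^-∸ w j≤n)) (drops-star^ (n ∸ j) d)

  star^-ext-before : ∀ {j} → KeepsBefore α w j → n ≤ℕ j → star^ n (ext α w) ≡ ext α (star^ n w)
  star^-ext-before {n = zero}  keeps _   = refl
  star^-ext-before {n = suc n} keeps n<j =
    trans (cong star (star^-ext-before keeps (ℕ.<⇒≤ n<j))) (star-ext-keeps (keeps n<j))

  star^-ext-after : ∀ {j} → Drops α (star^ j w) → KeepsBefore α w j → j ≤ℕ n →
                    star^ (suc n) (ext α w) ≡ star^ n w
  star^-ext-after {α = α} {w = w} {j = j} dj keeps j≤n =
    trans (star^-shift dropped (s≤s j≤n)) (cong (λ i → star^ i w) (ℕ.m∸n+n≡m j≤n))
    where
    dropped : star^ (suc j) (ext α w) ≡ star^ j w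
    dropped = trans (cong star (star^-ext-before keeps ℕ.≤-refl)) (star-ext-drops dj)

  ext-length<⇒≢ : length u <ℕ length v → ext α u ≢ ext α v
  ext-length<⇒≢ |u|<|v| = length<⇒≢ (subst₂ _<ℕ_ (sym length-ext) (sym length-ext) (s≤s |u|<|v|))

  ext-monoˡ-fork : ∀ {l m} w → l < m → Fork (ext l w) (ext m w)
  ext-monoˡ-fork {l} {m} w l<m with dropIndex l w | dropIndex m w
  ... | a , da , keeps-l | b , db , keeps-m =
    descend (b ∸ a) (ℕ.≤-reflexive (ℕ.m∸n+n≡m a≤b))
      (subst (λ i → star (ext m (star^ i w)) ≡ star^ i w) (sym (ℕ.m∸n+n≡m a≤b)) (star-ext-drops db))
    where
    a≤b : a ≤ℕ b
    a≤b = ℕ.≮⇒≥ λ b<a → keeps-l b<a (drops-antitone (ℕ.<⇒≤ l<m) db)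

    -- From step a on, ext l w has shed l and descends like w, while up to step b
    -- ext m w descends like ext m (star^ i w).  The sequences fork right after the
    -- largest i < b with star^ i w ≢ ext m (star^ (suc i) w), or else at step a,
    -- where l < m decides.
    descend : ∀ n → n + a ≤ℕ b → star (ext m (star^ (n + a) w)) ≡ star^ (n + a) w →
              Fork (ext l w) (ext m w)
    descend zero _ parent =
      fork a a (star^-ext-before keeps-l ℕ.≤-refl) (star^-ext-before keeps-m a≤b)
        (trans (star-ext-drops da) (sym parent)) (ext-monoˡ-<colex l<m)
    descend (suc n) i<b parent with star^ (n + a) w ≟ˡ ext m (star^ (suc n + a) w)
    ... | yes same   = descend n (ℕ.<⇒≤ i<b) (trans (star-ext-keeps (keeps-m i<b)) (sym same))
    ... | no  differ =
      fork (suc n + a) (suc n + a)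
        (star^-ext-after da keeps-l (ℕ.m≤n+m a n)) (star^-ext-before keeps-m i<b)
        (sym parent) (parent-<colex-ext refl parent (keeps-m i<b) differ)

  ext-InSeq : x ≢ y → InSeq x y → ext α x ≺′ ext α y
  ext-InSeq {x = x} {y = y} {α = α} x≢y x∈y
    with least (λ i → star^ i y ≟ˡ x) (proj₁ x∈y) (proj₂ x∈y)
  ... | zero  , y≡x    , _       = contradiction (sym y≡x) x≢y
  ... | suc s , parent , not-yet with dropIndex α y
  ...   | j , dj , keeps with ℕ.≤-<-connex j s
  ...     | inj₂ s<j =
    inj₁ (ext-length<⇒≢ (InSeq⇒length< x≢y x∈y) , suc s ,
          trans (star^-ext-before keeps s<j) (cong (ext α) parent))
  ...     | inj₁ j≤s with star^ s y ≟ˡ ext α x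
  ...       | yes c≡ext =
    inj₁ (ext-length<⇒≢ (InSeq⇒length< x≢y x∈y) , suc s , trans (star^-ext-after dj keeps j≤s) c≡ext)
  ...       | no  c≢ext =
    inj₂ (fork 0 (suc s) refl (star^-ext-after dj keeps j≤s) (trans (star-ext-drops dx) (sym parent))
           (ext-<colex-parent parent dc c≢[] c≢ext))
    where
    dc : Drops α (star^ s y)
    dc = drops-later dj j≤s
    dx : Drops α x
    dx = subst (Drops α) parent (drops-star dc)
    c≢[] : star^ s y ≢ []
    c≢[] c≡[] = not-yet (ℕ.n<1+n s) (trans c≡[] (trans (cong star (sym c≡[])) parent))

  fork-ext-InSeq : Fork u (ext α v) → InSeq v y → u ≺′ ext α y
  fork-ext-InSeq {v = v} {y = y} f v∈y with v ≟ˡ y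
  ... | yes refl = inj₂ f
  ... | no  v≢y  = ≺′-trans (inj₂ f) (ext-InSeq v≢y v∈y)

  ext-mono-≺′ : x ≺′ y → ext α x ≺′ ext α y
  ext-mono-≺′ (inj₁ (x≢y , x∈y)) = ext-InSeq x≢y x∈y
  ext-mono-≺′ {x = x} {y = y} {α = α} (inj₂ (s , t , meet , lt)) with dropIndex α x | dropIndex α y
  ... | jx , dx , keeps-x | jy , dy , keeps-y with ℕ.≤-<-connex jx s | ℕ.≤-<-connex jy t
  ... | inj₁ jx≤s | inj₁ jy≤t =
    inj₂ (fork (suc s) (suc t) (star^-ext-after dx keeps-x jx≤s) (star^-ext-after dy keeps-y jy≤t) meet lt)
  ... | inj₂ s<jx | inj₂ t<jy =
    inj₂ (fork s t (star^-ext-before keeps-x (ℕ.<⇒≤ s<jx)) (star^-ext-before keeps-y (ℕ.<⇒≤ t<jy))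
           (trans (star-ext-keeps (keeps-x s<jx))
             (trans (cong (ext α) meet) (sym (star-ext-keeps (keeps-y t<jy)))))
           (ext-monoʳ-<colex lt))
  ... | inj₁ jx≤s | inj₂ t<jy =
    contradiction (drops-mono-<colex meet lt (drops-later dx jx≤s)) (keeps-y t<jy)
  ... | inj₂ s<jx | inj₁ jy≤t with ext α (star (star^ s x)) ≟ˡ star^ t y
  ...   | no differ =
    inj₂ (fork (suc s) (suc t) (star^-ext-before keeps-x s<jx) (star^-ext-after dy keeps-y jy≤t)
           (trans (star-ext-drops (subst (Drops α) (sym meet) (drops-star dd))) meet)
           (ext-<colex-parent (sym meet) dd (<colex⇒≢[]ʳ lt) (differ ∘ sym)))
    where
    dd : Drops α (star^ t y)
    dd = drops-later dy jy≤t
  ...   | yes same =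
    fork-ext-InSeq
      (fork s 0 (star^-ext-before keeps-x (ℕ.<⇒≤ s<jx)) refl
        (trans (star-ext-keeps (keeps-x s<jx)) (trans same (sym (star-ext-drops (drops-later dy jy≤t)))))
        (ext-monoʳ-<colex lt))
      (t , refl)

  ≺-ext : ∀ {l m} → l ≤ m → x ≺ y → ext l x ≺ ext m y
  ≺-ext {x = x} {l = l} {m} l≤m x≺y with l Fin.≟ m
  ... | yes refl = ≺′⇒≺ (ext-mono-≺′ (≺⇒≺′ x≺y))
  ... | no  l≢m  =
    ≺′⇒≺ (≺′-trans (inj₂ (ext-monoˡ-fork x (Fin.≤∧≢⇒< l≤m l≢m))) (ext-mono-≺′ (≺⇒≺′ x≺y)))

-- Prepending a letter

linked-head-≤ : a ≤ b → Linked _≤_ (b ∷ w) → Linked _≤_ (a ∷ w)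
linked-head-≤ a≤b [-]          = [-]
linked-head-≤ a≤b (b≤c ∷ rest) = ℕ.≤-trans a≤b b≤c ∷ rest

linked-∷-star : Linked _≤_ (α ∷ w) → Linked _≤_ (α ∷ star w)
linked-∷-star {w = []}    [-]                                    = [-]
linked-∷-star {w = b ∷ w} (α≤b ∷ sorted) rewrite star-linked sorted = linked-head-≤ α≤b sorted

unlinked-<colex-∷-star : ∀ α a (w : List (Fin k)) → ¬ Linked _≤_ (a ∷ w) →
                         (a ∷ w) <colex α ∷ star (a ∷ w)
unlinked-<colex-∷-star α a []      unsorted = contradiction [-] unsorted
unlinked-<colex-∷-star α a (b ∷ w) unsorted =
  subst (λ v → (a ∷ b ∷ w) <colex α ∷ v) (sym (star-unlinked unsorted))
    (there a α (tail< (linked? _≤?_ (b ∷ w))))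
  where
  tail< : Dec (Linked _≤_ (b ∷ w)) → (b ∷ w) <colex a ∷ star (b ∷ w)
  tail< (yes sorted)    = subst (λ v → (b ∷ w) <colex a ∷ v) (sym (star-linked sorted))
                            (here (ℕ.≰⇒> λ a≤b → unsorted (a≤b ∷ sorted)))
  tail< (no  unsorted′) = unlinked-<colex-∷-star a b w unsorted′

parent-<colex-∷ : star c ≡ z → ¬ Linked _≤_ (α ∷ c) → c <colex α ∷ z
parent-<colex-∷ {c = []}                refl unsorted = contradiction [-] unsorted
parent-<colex-∷ {c = e ∷ c} {α = α} refl unsorted with linked? _≤?_ (e ∷ c)
... | yes sorted rewrite star-linked sorted = here (ℕ.≰⇒> λ α≤e → unsorted (α≤e ∷ sorted))
... | no  unsorted′ = unlinked-<colex-∷-star α e c unsorted′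

∷-<colex-parent : star c ≡ z → Linked _≤_ (α ∷ c) → c ≢ [] → c ≢ α ∷ z → α ∷ z <colex c
∷-<colex-parent {c = []}    _    _              c≢[] _     = contradiction refl c≢[]
∷-<colex-parent {c = e ∷ c} refl (α≤e ∷ sorted) _    c≢α∷z rewrite star-linked sorted =
  here (Fin.≤∧≢⇒< α≤e λ α≡e → c≢α∷z (cong (_∷ c) (sym α≡e)))

linked-∷-mono-<colex : star c ≡ star d → c <colex d → Linked _≤_ (α ∷ c) → Linked _≤_ (α ∷ d)
linked-∷-mono-<colex {c = e ∷ c} {d = f ∷ d} siblings lt (α≤e ∷ sorted) with linked? _≤?_ (f ∷ d)
... | yes sorted′ = ℕ.≤-trans α≤e (ℕ.<⇒≤ (<colex-∷-head same-tail)) ∷ sorted′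
  where
  same-tail : (e ∷ d) <colex (f ∷ d)
  same-tail = subst (λ v → (e ∷ v) <colex (f ∷ d))
                (trans (sym (star-linked sorted)) (trans siblings (star-linked sorted′))) lt
... | no  unsorted = contradiction (<colex-trans lt d<c) <colex-irrefl
  where
  d<c : (f ∷ d) <colex (e ∷ c)
  d<c = subst (λ v → (f ∷ d) <colex (e ∷ v)) (trans (sym siblings) (star-linked sorted))
          (unlinked-<colex-∷-star e f d unsorted)

prepend : ∀ k → Extension k
prepend k = record
  { ext               = _∷_
  ; Drops             = λ α w → Linked _≤_ (α ∷ w)
  ; drops?            = λ α w → linked? _≤?_ (α ∷ w)
  ; star-ext-drops    = star-linked
  ; star-ext-keeps    = star-unlinked
  ; length-ext        = refl
  ; drops-[]          = [-]
  ; drops-star        = linked-∷-star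
  ; drops-antitone    = linked-head-≤
  ; ext-monoˡ-<colex  = here
  ; ext-monoʳ-<colex  = there _ _
  ; parent-<colex-ext = λ parent _ unsorted _ → parent-<colex-∷ parent unsorted
  ; ext-<colex-parent = ∷-<colex-parent
  ; drops-mono-<colex = linked-∷-mono-<colex
  }

-- Appending a letter

infix 4 _<last_

_<last_ : Fin k → List (Fin k) → Set
α <last w = All (α <_) (last w)

last-∷ʳ : (w : List (Fin k)) → last (w ∷ʳ a) ≡ just a
last-∷ʳ []          = refl
last-∷ʳ (b ∷ [])    = refl
last-∷ʳ (b ∷ c ∷ w) = last-∷ʳ (c ∷ w)

length-∷ʳ : (w : List (Fin k)) → length (w ∷ʳ a) ≡ suc (length w)
length-∷ʳ w = trans (length-++ w) (ℕ.+-comm (length w) 1)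

<last-∷ʳ⁻ : ∀ w → α <last (w ∷ʳ a) → α < a
<last-∷ʳ⁻ {α = α} w p = drop-just (subst (All (α <_)) (last-∷ʳ w) p)

<last-∷ʳ⁺ : ∀ w → α < a → α <last (w ∷ʳ a)
<last-∷ʳ⁺ {α = α} w α<a = subst (All (α <_)) (sym (last-∷ʳ w)) (just α<a)

<last-tail : ∀ w → α <last (a ∷ w) → α <last w
<last-tail []      _ = nothing
<last-tail (_ ∷ _) p = p

<last-mono-<colex : u <colex v → α <last u → α <last v
<last-mono-<colex (here {w = []} a<b)        (just α<a) = just (ℕ.<-trans α<a a<b)
<last-mono-<colex (here {w = _ ∷ _} _)       p          = p
<last-mono-<colex (there _ _ q@(here _))      p          = <last-mono-<colex q p
<last-mono-<colex (there _ _ q@(there _ _ _)) p          = <last-mono-<colex q p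

<last⇒unlinked-∷ʳ : ∀ a w → α <last (a ∷ w) → ¬ Linked _≤_ ((a ∷ w) ∷ʳ α)
<last⇒unlinked-∷ʳ a []      (just α<a) (a≤α ∷ _)  = ℕ.<⇒≱ α<a a≤α
<last⇒unlinked-∷ʳ a (b ∷ w) α<last     (_ ∷ rest) = <last⇒unlinked-∷ʳ b w α<last rest

≮last⇒connected : ∀ w → ¬ α <last w → Connected _≤_ (last w) (just α)
≮last⇒connected w α≮last with last w
... | just a  = just (ℕ.≮⇒≥ (α≮last ∘ just))
... | nothing = nothing-just

linked-∷ʳ⁻ : Linked _≤_ (w ∷ʳ α) → Linked _≤_ w
linked-∷ʳ⁻ {w = []}        _            = []
linked-∷ʳ⁻ {w = a ∷ []}    _            = [-]
linked-∷ʳ⁻ {w = a ∷ b ∷ w} (a≤b ∷ rest) = a≤b ∷ linked-∷ʳ⁻ rest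

star-∷ʳ-<last : ∀ w → α <last w → star (w ∷ʳ α) ≡ w
star-∷ʳ-<last []          _      = refl
star-∷ʳ-<last (a ∷ [])    α<last = star-unlinked (<last⇒unlinked-∷ʳ a [] α<last)
star-∷ʳ-<last (a ∷ b ∷ w) α<last =
  trans (star-unlinked (<last⇒unlinked-∷ʳ a (b ∷ w) α<last))
        (cong (a ∷_) (star-∷ʳ-<last (b ∷ w) α<last))

star-∷ʳ-≮last : ∀ w → ¬ α <last w → star (w ∷ʳ α) ≡ star w ∷ʳ α
star-∷ʳ-≮last []          α≮last = contradiction nothing α≮last
star-∷ʳ-≮last (a ∷ [])    α≮last = star-linked (++⁺ [-] (≮last⇒connected (a ∷ []) α≮last) [-])
star-∷ʳ-≮last {α = α} (a ∷ b ∷ w) α≮last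
  with linked? _≤?_ (a ∷ b ∷ w) | star-∷ʳ-≮last (b ∷ w) α≮last
... | yes sorted   | _  = trans (star-linked (++⁺ sorted (≮last⇒connected (b ∷ w) α≮last) [-]))
                              (cong (_∷ʳ α) (sym (star-linked sorted)))
... | no  unsorted | ih = trans (star-unlinked (unsorted ∘ linked-∷ʳ⁻))
                              (trans (cong (a ∷_) ih) (cong (_∷ʳ α) (sym (star-unlinked unsorted))))

<last-star : ∀ w → α <last w → α <last star w
<last-star []      _      = nothing
<last-star (a ∷ w) α<last with linked? _≤?_ (a ∷ w)
... | yes sorted   = subst (_ <last_) (sym (star-linked sorted)) (<last-tail w α<last)
... | no  unsorted =
  <last-tail (star (a ∷ w)) (<last-mono-<colex (unlinked-<colex-∷-star a a w unsorted) α<last)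

∷ʳ-<colex : length u ≡ length v → a < b → u ∷ʳ a <colex v ∷ʳ b
∷ʳ-<colex {u = []}    {v = []}    _   a<b = here a<b
∷ʳ-<colex {u = c ∷ u} {v = d ∷ v} len a<b = there c d (∷ʳ-<colex (ℕ.suc-injective len) a<b)

∷ʳ-monoˡ-<colex : u <colex v → u ∷ʳ a <colex v ∷ʳ a
∷ʳ-monoˡ-<colex (here b<c)    = here b<c
∷ʳ-monoˡ-<colex (there b c p) = there b c (∷ʳ-monoˡ-<colex p)

length-star-∷ʳ : ∀ a (w : List (Fin k)) → length (star (w ∷ʳ a)) ≡ length w
length-star-∷ʳ a w = trans (length-star (w ∷ʳ a)) (cong pred (length-∷ʳ w))

∷ʳ-<colex-parent : ∀ c → star c ≡ z → α <last c → c ≢ [] → z ∷ʳ α <colex c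
∷ʳ-<colex-parent c refl α<last c≢[] with reverseView c
... | []           = contradiction refl c≢[]
... | c′ ∶ _ ∶ʳ β = ∷ʳ-<colex (length-star-∷ʳ β c′) (<last-∷ʳ⁻ c′ α<last)

≮last-∷ʳ : ∀ w → ¬ α <last (w ∷ʳ α)
≮last-∷ʳ w α<last = ℕ.<-irrefl refl (<last-∷ʳ⁻ w α<last)

parent-<colex-∷ʳ : Reverse c → star c ≡ z → star (z ∷ʳ α) ≡ z → ¬ α <last c → c ≢ z ∷ʳ α →
                   c <colex z ∷ʳ α
parent-<colex-∷ʳ []                          _    _     α≮last _  = contradiction nothing α≮last
parent-<colex-∷ʳ {α = α} (c′ ∶ c′-view ∶ʳ β) refl fixed α≮last c≢ with β Fin.≟ α
... | no β≢α = ∷ʳ-<colex (sym (length-star-∷ʳ β c′)) (Fin.≤∧≢⇒< β≤α β≢α)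
  where
  β≤α : β ≤ α
  β≤α = ℕ.≮⇒≥ (α≮last ∘ <last-∷ʳ⁺ c′)
... | yes refl with All.dec (α <?_) (last c′)
...   | yes α<last  = contradiction (cong (_∷ʳ α) (sym (star-∷ʳ-<last c′ α<last))) c≢
...   | no  α≮last′ = subst (λ v → c′ ∷ʳ α <colex v ∷ʳ α) (sym parent) (∷ʳ-monoˡ-<colex ih)
  where
  parent : star (c′ ∷ʳ α) ≡ star c′ ∷ʳ α
  parent = star-∷ʳ-≮last c′ α≮last′
  fixed′ : star (star c′ ∷ʳ α) ≡ star c′
  fixed′ = ∷ʳ-injectiveˡ _ _ (begin
    star (star c′ ∷ʳ α) ∷ʳ α        ≡⟨ star-∷ʳ-≮last (star c′ ∷ʳ α) (≮last-∷ʳ (star c′)) ⟨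
    star ((star c′ ∷ʳ α) ∷ʳ α)      ≡⟨ cong (λ v → star (v ∷ʳ α)) parent ⟨
    star (star (c′ ∷ʳ α) ∷ʳ α)      ≡⟨ fixed ⟩
    star (c′ ∷ʳ α)                  ≡⟨ parent ⟩
    star c′ ∷ʳ α                    ∎)
    where open ≡-Reasoning
  ih : c′ <colex star c′ ∷ʳ α
  ih = parent-<colex-∷ʳ c′-view refl fixed′ α≮last′
         λ c′≡ → c≢ (cong (_∷ʳ α) (trans c′≡ (sym parent)))

append : ∀ k → Extension k
append k = record
  { ext               = λ α w → w ∷ʳ α
  ; Drops             = _<last_
  ; drops?            = λ α w → All.dec (α <?_) (last w)
  ; star-ext-drops    = λ {_} {w} → star-∷ʳ-<last w
  ; star-ext-keeps    = λ {_} {w} → star-∷ʳ-≮last w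
  ; length-ext        = λ {_} {w} → length-∷ʳ w
  ; drops-[]          = nothing
  ; drops-star        = λ {_} {w} → <last-star w
  ; drops-antitone    = λ l≤m → All.map (ℕ.≤-<-trans l≤m)
  ; ext-monoˡ-<colex  = ∷ʳ-<colex refl
  ; ext-monoʳ-<colex  = ∷ʳ-monoˡ-<colex
  ; parent-<colex-ext = λ {_} {c} parent → parent-<colex-∷ʳ (reverseView c) parent
  ; ext-<colex-parent = λ {_} {c} parent α<last c≢[] _ → ∷ʳ-<colex-parent c parent α<last c≢[]
  ; drops-mono-<colex = λ _ → <last-mono-<colex
  }

lemma6 : (k : ℕ) (x y : List (Fin k)) (l m : Fin k) → l ≤ m → x ≺ y →
           ((l ∷ x) ≺ (m ∷ y)) × ((x ∷ʳ l) ≺ (y ∷ʳ m))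
lemma6 k x y l m l≤m x≺y =
  Extend.≺-ext (prepend k) l≤m x≺y , Extend.≺-ext (append k) l≤m x≺y
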